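{- Let $p\ge 2$ and $2\le s\le r$ be integers. Then $$F_v(2_r,p;r+p-1) \le F_v(2_s,p;s+p-1) + r - s.$$
   Context: All graphs are finite, simple, undirected. For a graph $G$, $G \overset{v}{\rightarrow} (a_1,\dots,a_s)$ means: for every coloring of $V(G)$ with $s$ colors there is an $i$ such that $G$ contains an $a_i$-clique all of whose vertices have color $i$. $F_v(a_1,\dots,a_s;q)$ is the minimum number of vertices of a graph $G$ with $G \overset{v}{\rightarrow} (a_1,\dots,a_s)$ and clique number $\omega(G)<q$. $(2_t,p)$ denotes $t$ twos followed by $p$. -}

module Defs where

open import Data.Nat using (ℕ; zero; suc; _<_)
open import Data.Fin using (Fin; zero; suc)
open import Data.Bool using (Bool; true; false)
open import Data.Product using (Σ; ∃; _×_)
open import Relation.Binary.PropositionalEquality using (_≡_; _≢_)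
open import Relation.Nullary using (¬_)
open import Function.Definitions using (Injective)

record Graph (n : ℕ) : Set where
  field
    adj   : Fin n → Fin n → Bool
    sym   : ∀ u v → adj u v ≡ adj v u
    irrefl : ∀ v → adj v v ≡ false
open Graph public

IsClique : ∀ {n k} → Graph n → (Fin k → Fin n) → Set
IsClique {k = k} G f =
  Injective _≡_ _≡_ f × (∀ (i j : Fin k) → i ≢ j → adj G (f i) (f j) ≡ true)

HasClique : ∀ {n} → Graph n → ℕ → Set
HasClique {n} G k = Σ (Fin k → Fin n) λ f → IsClique G f

CliqueNumLt : ∀ {n} → Graph n → ℕ → Set
CliqueNumLt G q = ¬ HasClique G q

VArrows : ∀ {n s} → Graph n → (Fin s → ℕ) → Set
VArrows {n} {s} G a =
  ∀ (col : Fin n → Fin s) →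
    ∃ λ (i : Fin s) → Σ (Fin (a i) → Fin n) λ f →
      IsClique G f × (∀ j → col (f j) ≡ i)

IsFv : ∀ {s} → (Fin s → ℕ) → ℕ → ℕ → Set
IsFv a q N =
  (Σ (Graph N) λ G → VArrows G a × CliqueNumLt G q)
  × (∀ (m : ℕ) (G : Graph m) → VArrows G a → CliqueNumLt G q → ¬ (m < N))

-- The sequence (2_t, p) = (2,…,2,p) with t twos, of length t+1.
twos : (t : ℕ) → ℕ → Fin (suc t) → ℕ
twos zero    p zero    = p
twos (suc t) p zero    = 2
twos (suc t) p (suc i) = twos t p i

module Submission where

-- Let K₁ + G be G with a new vertex (the apex) joined to every vertex.
-- Its cliques are cliques of G, possibly with the apex added, so ω grows by exactly
-- one.  If G →v (2_t,p) then K₁ + G →v (2_{t+1},p): colour G by merging the new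
-- colour 0 into the apex colour; a monochromatic clique of G then either avoids
-- colour 0, contains two colour-0 vertices (a colour-0 edge), or contains exactly
-- one, which the apex can replace.  Applying K₁ + _ r − s times to an extremal
-- graph for F_v(2_s,p;s+p−1) gives the bound.

open import Defs hiding (sym)
open import Data.Nat using (ℕ; zero; suc; _+_; _∸_; _≤_; s≤s; z≤n)
open import Data.Nat.Properties using (≮⇒≥; ≤-trans; m≤m+n; +-comm; +-assoc; +-∸-assoc; m∸n+n≡m)
open import Data.Fin using (Fin; zero; suc; punchIn)
open import Data.Fin.Properties using (any?; punchIn-injective; punchInᵢ≢i; suc-injective; _≟_)
open import Data.Vec.Functional using ([]; _∷_)
open import Data.Bool using (Bool; true; false)
open import Data.Product using (Σ; ∃; _×_; _,_; proj₁; proj₂)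
open import Data.Empty using (⊥-elim)
open import Function using (_∘_)
open import Function.Definitions using (Injective)
open import Relation.Nullary using (yes; no)
open import Relation.Nullary.Decidable using (¬?; _×-dec_)
open import Relation.Binary.PropositionalEquality

MonoClique : ∀ {n s} → Graph n → (Fin n → Fin s) → Fin s → ℕ → Set
MonoClique {n} G col i k = Σ (Fin k → Fin n) λ f → IsClique G f × (∀ j → col (f j) ≡ i)

clique∘injective : ∀ {n k l} (G : Graph n) {f : Fin k → Fin n} {g : Fin l → Fin k} →
  IsClique G f → Injective _≡_ _≡_ g → IsClique G (f ∘ g)
clique∘injective G (f-inj , f-adj) g-inj =
  g-inj ∘ f-inj , λ i j i≢j → f-adj _ _ (i≢j ∘ g-inj)

edge⇒clique : ∀ {n} (G : Graph n) {u v} → adj G u v ≡ true → IsClique G (u ∷ v ∷ [])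
edge⇒clique G {u} {v} uv = injective , adjacent
  where
  u≢v : u ≢ v
  u≢v refl with trans (sym uv) (irrefl G u)
  ... | ()
  injective : Injective _≡_ _≡_ (u ∷ v ∷ [])
  injective {zero}     {zero}     _ = refl
  injective {zero}     {suc zero} e = ⊥-elim (u≢v e)
  injective {suc zero} {zero}     e = ⊥-elim (u≢v (sym e))
  injective {suc zero} {suc zero} _ = refl
  adjacent : ∀ i j → i ≢ j → adj G ((u ∷ v ∷ []) i) ((u ∷ v ∷ []) j) ≡ true
  adjacent zero       zero       i≢j = ⊥-elim (i≢j refl)
  adjacent zero       (suc zero) _   = uv
  adjacent (suc zero) zero       _   = trans (Graph.sym G v u) uv
  adjacent (suc zero) (suc zero) i≢j = ⊥-elim (i≢j refl)

monoEdge : ∀ {n s} (G : Graph n) (col : Fin n → Fin s) {i} u v →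
  adj G u v ≡ true → col u ≡ i → col v ≡ i → MonoClique G col i 2
monoEdge G col u v uv cu cv = _ , edge⇒clique G uv , λ { zero → cu ; (suc zero) → cv }

coneAdj : ∀ {n} → Graph n → Fin (suc n) → Fin (suc n) → Bool
coneAdj G zero    zero    = false
coneAdj G zero    (suc v) = true
coneAdj G (suc u) zero    = true
coneAdj G (suc u) (suc v) = adj G u v

coneAdj-sym : ∀ {n} (G : Graph n) u v → coneAdj G u v ≡ coneAdj G v u
coneAdj-sym G zero    zero    = refl
coneAdj-sym G zero    (suc v) = refl
coneAdj-sym G (suc u) zero    = refl
coneAdj-sym G (suc u) (suc v) = Graph.sym G u v

coneAdj-irrefl : ∀ {n} (G : Graph n) v → coneAdj G v v ≡ false
coneAdj-irrefl G zero    = refl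
coneAdj-irrefl G (suc v) = irrefl G v

cone : ∀ {n} → Graph n → Graph (suc n)
cone G = record { adj = coneAdj G ; sym = coneAdj-sym G ; irrefl = coneAdj-irrefl G }

cone-liftClique : ∀ {n k} (G : Graph n) {f : Fin k → Fin n} →
  IsClique G f → IsClique (cone G) (suc ∘ f)
cone-liftClique G (f-inj , f-adj) = f-inj ∘ suc-injective , f-adj

withApexAt : ∀ {n k} → (Fin k → Fin n) → Fin k → Fin k → Fin (suc n)
withApexAt f j₀ j with j ≟ j₀
... | yes _ = zero
... | no  _ = suc (f j)

cone-withApexAt-clique : ∀ {n k} (G : Graph n) {f : Fin k → Fin n} →
  IsClique G f → ∀ j₀ → IsClique (cone G) (withApexAt f j₀)
cone-withApexAt-clique G {f} (f-inj , f-adj) j₀ = injective , adjacent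
  where
  injective : Injective _≡_ _≡_ (withApexAt f j₀)
  injective {i} {j} e with i ≟ j₀ | j ≟ j₀
  injective e | yes i≡j₀ | yes j≡j₀ = trans i≡j₀ (sym j≡j₀)
  injective () | yes _ | no _
  injective () | no _  | yes _
  injective e | no _   | no _ = f-inj (suc-injective e)
  adjacent : ∀ i j → i ≢ j → coneAdj G (withApexAt f j₀ i) (withApexAt f j₀ j) ≡ true
  adjacent i j i≢j with i ≟ j₀ | j ≟ j₀
  ... | yes i≡j₀ | yes j≡j₀ = ⊥-elim (i≢j (trans i≡j₀ (sym j≡j₀)))
  ... | yes _    | no _     = refl
  ... | no _     | yes _    = refl
  ... | no _     | no _     = f-adj i j i≢j

apexFree⇒clique : ∀ {n k} (G : Graph n) (f : Fin k → Fin (suc n)) →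
  IsClique (cone G) f → (∀ j → f j ≢ zero) → HasClique G k
apexFree⇒clique {n} {k} G f (f-inj , f-adj) apexFree = h , h-inj , h-adj
  where
  below : ∀ j → ∃ λ (v : Fin n) → suc v ≡ f j
  below j with f j | apexFree j
  ... | zero  | f≢0 = ⊥-elim (f≢0 refl)
  ... | suc v | _   = v , refl
  h : Fin k → Fin n
  h j = proj₁ (below j)
  suc-h : ∀ j → suc (h j) ≡ f j
  suc-h j = proj₂ (below j)
  h-inj : Injective _≡_ _≡_ h
  h-inj {i} {j} e = f-inj (trans (sym (suc-h i)) (trans (cong suc e) (suc-h j)))
  h-adj : ∀ i j → i ≢ j → adj G (h i) (h j) ≡ true
  h-adj i j i≢j = subst₂ (λ u v → coneAdj G u v ≡ true) (sym (suc-h i)) (sym (suc-h j)) (f-adj i j i≢j)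

-- Drop the apex if it occurs, and otherwise an arbitrary vertex.
apexFreePunchIn : ∀ {n q} {f : Fin (suc q) → Fin (suc n)} →
  Injective _≡_ _≡_ f → ∃ λ j₀ → ∀ j → f (punchIn j₀ j) ≢ zero
apexFreePunchIn {f = f} f-inj with any? (λ j → f j ≟ zero)
... | yes (j₀ , fj₀≡0) = j₀ , λ j e → punchInᵢ≢i j₀ j (f-inj (trans e (sym fj₀≡0)))
... | no noApex        = zero , λ j e → noApex (suc j , e)

cone-cliqueNumLt : ∀ {n q} (G : Graph n) → CliqueNumLt G q → CliqueNumLt (cone G) (suc q)
cone-cliqueNumLt G noClique (f , clique@(f-inj , _)) with apexFreePunchIn f-inj
... | j₀ , apexFree =
  noClique (apexFree⇒clique G (f ∘ punchIn j₀)
    (clique∘injective (cone G) clique (punchIn-injective j₀ _ _)) apexFree)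

-- Colour 0 of (2_{t+1},p) is merged into colour d of (2_t,p); the others move down.
mergeInto : ∀ {t} → Fin (suc t) → Fin (suc (suc t)) → Fin (suc t)
mergeInto d zero    = d
mergeInto d (suc c) = c

mergeInto-≢zero : ∀ {t} {d i : Fin (suc t)} {c} → c ≢ zero → mergeInto d c ≡ i → c ≡ suc i
mergeInto-≢zero {c = zero}  c≢0 _ = ⊥-elim (c≢0 refl)
mergeInto-≢zero {c = suc c} _   e = cong suc e

module ConeColouring {n t} (G : Graph n) (col : Fin (suc n) → Fin (suc (suc t)))
                     (d : Fin (suc t)) where

  col′ : Fin n → Fin (suc t)
  col′ = mergeInto d ∘ col ∘ suc

  liftMono : ∀ {k i} {f : Fin k → Fin n} → IsClique G f → (∀ j → col′ (f j) ≡ i) →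
    (∀ j → col (suc (f j)) ≢ zero) → MonoClique (cone G) col (suc i) k
  liftMono clique f-col noZero =
    _ , cone-liftClique G clique , λ j → mergeInto-≢zero (noZero j) (f-col j)

  -- The one colour-0 vertex j₀ has col′-colour d, so d = i and the apex (colour suc d) replaces it.
  replaceByApex : ∀ {k i} {f : Fin k → Fin n} → col zero ≡ suc d →
    IsClique G f → (∀ j → col′ (f j) ≡ i) →
    ∀ j₀ → col (suc (f j₀)) ≡ zero → (∀ j → j ≢ j₀ → col (suc (f j)) ≢ zero) →
    MonoClique (cone G) col (suc i) k
  replaceByApex {i = i} {f} apexCol clique f-col j₀ fj₀≡0 othersNonZero =
    withApexAt f j₀ , cone-withApexAt-clique G clique j₀ , colour
    where
    colour : ∀ j → col (withApexAt f j₀ j) ≡ suc i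
    colour j with j ≟ j₀
    ... | yes _   = trans apexCol (cong suc (trans (sym (cong (mergeInto d) fj₀≡0)) (f-col j₀)))
    ... | no j≢j₀ = mergeInto-≢zero (othersNonZero j j≢j₀) (f-col j)

cone-arrows : ∀ {n t p} (G : Graph n) → VArrows G (twos t p) → VArrows (cone G) (twos (suc t) p)
-- When the apex has colour 0 the merge target is irrelevant: any colour-0 vertex forms an edge with it.
cone-arrows G arrows col with col zero in apexCol
... | zero with arrows (ConeColouring.col′ G col zero)
...   | i , f , clique , f-col with any? (λ j → col (suc (f j)) ≟ zero)
...     | yes (j₀ , fj₀≡0) = zero , monoEdge (cone G) col zero (suc (f j₀)) refl apexCol fj₀≡0
...     | no noZero        = suc i , ConeColouring.liftMono G col zero clique f-col (λ j e → noZero (j , e))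
cone-arrows G arrows col | suc c with arrows (ConeColouring.col′ G col c)
...   | i , f , clique@(_ , f-adj) , f-col with any? (λ j → col (suc (f j)) ≟ zero)
...     | no noZero = suc i , ConeColouring.liftMono G col c clique f-col (λ j e → noZero (j , e))
...     | yes (j₀ , fj₀≡0) with any? (λ j → ¬? (j ≟ j₀) ×-dec (col (suc (f j)) ≟ zero))
...       | yes (j₁ , j₁≢j₀ , fj₁≡0) =
            zero , monoEdge (cone G) col (suc (f j₀)) (suc (f j₁)) (f-adj j₀ j₁ (j₁≢j₀ ∘ sym)) fj₀≡0 fj₁≡0
...       | no onlyJ₀ = suc i , ConeColouring.replaceByApex G col c apexCol clique f-col j₀ fj₀≡0
                                  (λ j j≢j₀ e → onlyJ₀ (j , j≢j₀ , e))

cone^ : ∀ {n} (k : ℕ) → Graph n → Graph (k + n)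
cone^ zero    G = G
cone^ (suc k) G = cone (cone^ k G)

cone^-arrows : ∀ {n t p} (k : ℕ) (G : Graph n) →
  VArrows G (twos t p) → VArrows (cone^ k G) (twos (k + t) p)
cone^-arrows zero    G arrows = arrows
cone^-arrows (suc k) G arrows = cone-arrows (cone^ k G) (cone^-arrows k G arrows)

cone^-cliqueNumLt : ∀ {n q} (k : ℕ) (G : Graph n) →
  CliqueNumLt G q → CliqueNumLt (cone^ k G) (k + q)
cone^-cliqueNumLt zero    G ω<q = ω<q
cone^-cliqueNumLt (suc k) G ω<q = cone-cliqueNumLt (cone^ k G) (cone^-cliqueNumLt k G ω<q)

∸+-shift : ∀ {s r} m → s ≤ r → 1 ≤ s → r ∸ s + (s + m ∸ 1) ≡ r + m ∸ 1
∸+-shift {s} {r} m s≤r 1≤s = begin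
  r ∸ s + (s + m ∸ 1)  ≡⟨ +-∸-assoc (r ∸ s) (≤-trans 1≤s (m≤m+n s m)) ⟨
  r ∸ s + (s + m) ∸ 1  ≡⟨ cong (_∸ 1) (+-assoc (r ∸ s) s m) ⟨
  r ∸ s + s + m ∸ 1    ≡⟨ cong (λ x → x + m ∸ 1) (m∸n+n≡m s≤r) ⟩
  r + m ∸ 1            ∎
  where open ≡-Reasoning

lemma1 : ∀ (p s r : ℕ) → 2 ≤ p → 2 ≤ s → s ≤ r →
    ∀ (Nr Ns : ℕ) →
    IsFv (twos r p) (r + p ∸ 1) Nr →
    IsFv (twos s p) (s + p ∸ 1) Ns →
    Nr ≤ Ns + (r ∸ s)
lemma1 p s r _ 2≤s s≤r Nr Ns (_ , Nr-minimal) ((G , arrows , ω<) , _) =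
  subst (Nr ≤_) (+-comm (r ∸ s) Ns) (≮⇒≥ (Nr-minimal _ (cone^ k G) arrows′ ω<′))
  where
  k : ℕ
  k = r ∸ s
  arrows′ : VArrows (cone^ k G) (twos r p)
  arrows′ = subst (λ x → VArrows (cone^ k G) (twos x p)) (m∸n+n≡m s≤r) (cone^-arrows k G arrows)
  ω<′ : CliqueNumLt (cone^ k G) (r + p ∸ 1)
  ω<′ = subst (CliqueNumLt (cone^ k G)) (∸+-shift p s≤r (≤-trans (s≤s z≤n) 2≤s)) (cone^-cliqueNumLt k G ω<)
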